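{- Let $\lambda=[\lambda_1,\ldots,\lambda_k]$ be a partition with frequency representation $[a_1,\ldots,a_{\lambda_1}]$, $n$ a positive integer, and $v$ a strictly increasing vector of length $k$ with entries in $\{1,\ldots,n\}$. Then the set of matrices in $P(v,\lambda,n)$ all of whose entries are nonnegative equals the transportation polytope $P_{(y,z)}$, where $y\in\mathbb{R}^{\lambda_1}$ has $y_i=a_{\lambda_1-i+1}$ for $1\le i\le\lambda_1$, and $z\in\mathbb{R}^n$ has $z_j=1$ if $j$ is an entry of $v$ and $z_j=0$ otherwise.
   Context: A partition is a weakly decreasing sequence of positive integers; $a_i$ is the number of parts equal to $i$. A sign matrix is a matrix with entries in $\{ -1,0,1\}$ whose column partial sums from the top lie in $\{0,1\}$ and whose row partial sums from the left are nonnegative. $M(v,\lambda,n)$ is the set of $\lambda_1\times n$ sign matrices whose $i$-th row sums to $a_{\lambda_1-i+1}$ for all $i$ and whose $j$-th column sums to $1$ if $j$ is an entry of $v$ and $0$ otherwise; $P(v,\lambda,n)$ is its convex hull in $\mathbb{R}^{\lambda_1 n}$. For $y\in\mathbb{R}_{\ge0}^p$, $z\in\mathbb{R}_{\ge0}^q$, the transportation polytope $P_{(y,z)}$ is the set of real $p\times q$ matrices $X$ with all entries $X_{ij}\ge0$, $\sum_{j}X_{ij}=y_i$ for all $i$, and $\sum_i X_{ij}=z_j$ for all $j$.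
   Formalization: Both polytopes $P(v,\lambda,n)$ and $P_{(y,z)}$ are taken over ℚ rather than the reals: their matrices have rational entries and the convex combinations use rational weights. -}

module Defs where

open import Data.Nat as ℕ using (ℕ; zero; suc)
open import Data.Integer as ℤ using (ℤ; +_; -[1+_])
open import Data.Rational as ℚ using (ℚ; 0ℚ; 1ℚ)
open import Data.Fin as Fin using (Fin; toℕ)
open import Data.Vec using (Vec; []; _∷_; lookup)
open import Data.Vec.Relation.Unary.Any using (any?)
open import Data.List using (List)
open import Data.List.Relation.Unary.All using (All)
open import Data.Product using (Σ; _×_; _,_; ∃)
open import Data.Sum using (_⊎_)
open import Data.Bool using (if_then_else_)
open import Relation.Nullary using (does)
open import Relation.Binary.PropositionalEquality using (_≡_)

psumℤ : (n : ℕ) → (Fin n → ℤ) → ℕ → ℤ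
psumℤ zero    f r       = + 0
psumℤ (suc n) f zero    = + 0
psumℤ (suc n) f (suc r) = f Fin.zero ℤ.+ psumℤ n (λ i → f (Fin.suc i)) r

sumℤ : (n : ℕ) → (Fin n → ℤ) → ℤ
sumℤ n f = psumℤ n f n

sumℚ : (n : ℕ) → (Fin n → ℚ) → ℚ
sumℚ zero    f = 0ℚ
sumℚ (suc n) f = f Fin.zero ℚ.+ sumℚ n (λ i → f (Fin.suc i))

sumℚL : {A : Set} → List A → (A → ℚ) → ℚ
sumℚL List.[] f = 0ℚ
sumℚL (x List.∷ xs) f = f x ℚ.+ sumℚL xs f

ℤtoℚ : ℤ → ℚ
ℤtoℚ z = z ℚ./ 1

ℕtoℚ : ℕ → ℚ
ℕtoℚ k = ℤtoℚ (+ k)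

IsPartition : {k : ℕ} → Vec ℕ k → Set
IsPartition {k} lam =
  (∀ (i : Fin k) → 1 ℕ.≤ lookup lam i) ×
  (∀ (i j : Fin k) → i Fin.≤ j → lookup lam j ℕ.≤ lookup lam i)

largest : {k : ℕ} → Vec ℕ k → ℕ
largest []        = 0
largest (x ∷ _)   = x

freq : {k : ℕ} → Vec ℕ k → ℕ → ℕ
freq []       m = 0
freq (x ∷ xs) m = (if does (x ℕ.≟ m) then 1 else 0) ℕ.+ freq xs m

-- Strictly increasing vectors of column indices (entries in {1..n},
-- represented 0-indexed by Fin n)

StrictlyIncreasing : {k n : ℕ} → Vec (Fin n) k → Set
StrictlyIncreasing {k} v = ∀ (i j : Fin k) → i Fin.< j → lookup v i Fin.< lookup v j

colTarget : {k n : ℕ} → Vec (Fin n) k → Fin n → ℕ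
colTarget v j = if does (any? (λ x → x Fin.≟ j) v) then 1 else 0

-- y_i = a_{λ_1 - i + 1}  (1-indexed i); with 0-indexed i this is a_{λ_1 - i}
rowTarget : {k : ℕ} (lam : Vec ℕ k) → Fin (largest lam) → ℕ
rowTarget lam i = freq lam (largest lam ℕ.∸ toℕ i)

Matℤ : ℕ → ℕ → Set
Matℤ m n = Fin m → Fin n → ℤ

Matℚ : ℕ → ℕ → Set
Matℚ m n = Fin m → Fin n → ℚ

IsSignEntry : ℤ → Set
IsSignEntry x = (x ≡ -[1+ 0 ]) ⊎ (x ≡ + 0) ⊎ (x ≡ + 1)

IsSignMatrix : {m n : ℕ} → Matℤ m n → Set
IsSignMatrix {m} {n} A =
  (∀ i j → IsSignEntry (A i j)) ×
  (∀ (j : Fin n) (r : ℕ) → r ℕ.≤ m →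
      (psumℤ m (λ i → A i j) r ≡ + 0) ⊎ (psumℤ m (λ i → A i j) r ≡ + 1)) ×
  (∀ (i : Fin m) (r : ℕ) → r ℕ.≤ n → + 0 ℤ.≤ psumℤ n (λ j → A i j) r)

InM : {k : ℕ} (n : ℕ) (v : Vec (Fin n) k) (lam : Vec ℕ k) →
      Matℤ (largest lam) n → Set
InM n v lam A =
  IsSignMatrix A ×
  (∀ i → sumℤ n (λ j → A i j) ≡ + rowTarget lam i) ×
  (∀ j → sumℤ (largest lam) (λ i → A i j) ≡ + colTarget v j)

InP : {k : ℕ} (n : ℕ) (v : Vec (Fin n) k) (lam : Vec ℕ k) →
      Matℚ (largest lam) n → Set
InP n v lam X =
  Σ (List (ℚ × Matℤ (largest lam) n)) λ ws →
    All (λ { (w , A) → (0ℚ ℚ.≤ w) × InM n v lam A }) ws ×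
    (sumℚL ws (λ { (w , A) → w }) ≡ 1ℚ) ×
    (∀ i j → X i j ≡ sumℚL ws (λ { (w , A) → w ℚ.* ℤtoℚ (A i j) }))

Nonneg : {m n : ℕ} → Matℚ m n → Set
Nonneg X = ∀ i j → 0ℚ ℚ.≤ X i j

InTransport : (p q : ℕ) (y : Fin p → ℚ) (z : Fin q → ℚ) → Matℚ p q → Set
InTransport p q y z X =
  Nonneg X ×
  (∀ i → sumℚ q (λ j → X i j) ≡ y i) ×
  (∀ j → sumℚ p (λ i → X i j) ≡ z j)

module Submission where

-- (⊆) Every sign matrix in M(v,λ,n) has row sums y and column sums z, and
--     margins are linear, so every convex combination of such matrices has
--     margins y and z as well.
-- (⊇) Here every column sum z_j is 0 or 1.  We show that a transportation
--     matrix X with integer margins y and column sums ≤ 1 is a convex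
--     combination of 0/1 matrices with the same margins; a 0/1 matrix with
--     these margins is a sign matrix in M(v,λ,n).  The proof is cycle
--     cancelling, by induction on the number of nonzero entries of X:
--     if X is not 0/1 it has a fractional cell (0 < x < 1); since margins are
--     integers, every fractional cell has another fractional cell in its row
--     and in its column, so there is an infinite alternating walk through
--     fractional cells.  Its first short repetition is a cycle C (a ±1 matrix
--     with zero margins), and X = t(X + αC) + (1−t)(X − βC) where both
--     matrices are nonnegative, have the margins of X and have fewer nonzero
--     entries.

open import Defs
import Data.Nat as Nat
open import Data.Nat using (ℕ; zero; suc; z≤n; s≤s)
import Data.Nat.Properties as ℕP
open import Data.Integer as ℤ using (ℤ; +_)
import Data.Integer.Properties as ℤP
open import Data.Rational as ℚ using (ℚ; 0ℚ; 1ℚ)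
import Data.Rational as Rat
import Data.Rational.Properties as ℚP
import Data.Rational.Unnormalised as ℚᵘ
import Data.Rational.Unnormalised.Properties as ℚᵘP
open import Data.Rational.Solver using (module +-*-Solver)
open import Data.Fin as Fin using (Fin; toℕ)
import Data.Fin.Properties as FinP
open import Data.Bool using (true; false; if_then_else_)
open import Data.Vec using (Vec)
open import Data.List using (List; []; _∷_; _++_; map)
open import Data.List.Relation.Unary.All as All using (All; []; _∷_)
import Data.List.Relation.Unary.All.Properties as AllP
open import Data.Product using (Σ; _×_; _,_; proj₁; proj₂)
open import Data.Sum using (_⊎_; inj₁; inj₂; [_,_]′)
open import Data.Empty using (⊥; ⊥-elim)
open import Relation.Nullary using (¬_; Dec; yes; no)
open import Relation.Nullary.Decidable using (_×-dec_; _⊎-dec_; ¬?)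
open import Relation.Binary.PropositionalEquality
open import Relation.Binary.Definitions using (tri<; tri≈; tri>)
open import Function.Bundles using (_⇔_; mk⇔)
open import Induction.WellFounded using (Acc; acc)
open import Data.Nat.Induction using (<-wellFounded)

-- A relation F between rows Fin m and columns Fin n is a bipartite graph.
-- A cycle in it visits distinct columns K u, each joined to two different
-- rows R u and R′ u; R and R′ are injective with the same image, so every
-- row of the cycle is met exactly twice.
record Cycle {m n : ℕ} (F : Fin m → Fin n → Set) : Set where
  field
    L : ℕ
    R R′ : Fin (suc L) → Fin m
    K : Fin (suc L) → Fin n
    R-injective : ∀ {u v} → R u ≡ R v → u ≡ v
    R′-injective : ∀ {u v} → R′ u ≡ R′ v → u ≡ v
    K-injective : ∀ {u v} → K u ≡ K v → u ≡ v
    R′≢R : ∀ u → R′ u ≢ R u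
    R′⊆R : ∀ u → Σ (Fin (suc L)) λ v → R v ≡ R′ u
    R⊆R′ : ∀ u → Σ (Fin (suc L)) λ v → R′ v ≡ R u
    edge : ∀ u → F (R u) (K u)
    edge′ : ∀ u → F (R′ u) (K u)

record Walk {m n : ℕ} (F : Fin m → Fin n → Set) : Set where
  field
    row : ℕ → Fin m
    col : ℕ → Fin n
    edge : ∀ t → F (row t) (col t)
    edge′ : ∀ t → F (row (suc t)) (col t)
    row-moves : ∀ t → row (suc t) ≢ row t
    col-moves : ∀ t → col (suc t) ≢ col t

flipRel : {m n : ℕ} → (Fin m → Fin n → Set) → Fin n → Fin m → Set
flipRel F j i = F i j

-- Every infinite walk contains a cycle: the first short repetition of a row
-- or a column of the walk closes one.
module WalksContainCycles where
  open Nat using (_+_; _≤_; _<_)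

  toℕ≤ : ∀ {e} (u : Fin (suc e)) → toℕ u ≤ e
  toℕ≤ u = Nat.s≤s⁻¹ (FinP.toℕ<n u)

  leastWitness : (P : ℕ → Set) → (∀ d → Dec (P d)) → ∀ d → P d →
                 Σ ℕ λ d₀ → P d₀ × (∀ d → d < d₀ → ¬ P d)
  leastWitness P P? d p = [ (λ below → ⊥-elim (below d (ℕP.n<1+n d) p)) , (λ least → least) ]′ (search (suc d))
    where
    search : ∀ k → (∀ d → d < k → ¬ P d) ⊎ Σ ℕ (λ d₀ → P d₀ × (∀ d → d < d₀ → ¬ P d))
    search zero = inj₁ (λ _ ())
    search (suc k) with search k
    ... | inj₂ w = inj₂ w
    ... | inj₁ below with P? k
    ...   | yes pk = inj₂ (k , pk , below)
    ...   | no ¬pk = inj₁ λ d d<1+k →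
              [ below d , (λ { refl → ¬pk }) ]′ (ℕP.m≤n⇒m<n∨m≡n (Nat.s≤s⁻¹ d<1+k))

  NoRepeat : {A : Set} → (ℕ → A) → ℕ → ℕ → Set
  NoRepeat f lo hi = ∀ b k → lo ≤ b → suc k + b ≤ hi → f b ≢ f (suc k + b)

  <⇒suc+ : ∀ {u v} → u < v → Σ ℕ λ k → v ≡ suc k + u
  <⇒suc+ {u} lt with ℕP.m≤n⇒∃[o]m+o≡n lt
  ... | k , e = k , trans (sym e) (cong suc (ℕP.+-comm u k))

  noRepeat⇒injective : {A : Set} (f : ℕ → A) {lo hi : ℕ} → NoRepeat f lo hi →
    ∀ {u v} → lo ≤ u → lo ≤ v → u ≤ hi → v ≤ hi → f u ≡ f v → u ≡ v
  noRepeat⇒injective f nr {u} {v} lo≤u lo≤v u≤hi v≤hi fu≡fv with ℕP.<-cmp u v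
  ... | tri≈ _ u≡v _ = u≡v
  ... | tri< u<v _ _ with <⇒suc+ u<v
  ...   | k , refl = ⊥-elim (nr u k lo≤u v≤hi fu≡fv)
  noRepeat⇒injective f nr lo≤u lo≤v u≤hi v≤hi fu≡fv | tri> _ _ v<u with <⇒suc+ v<u
  ...   | k , refl = ⊥-elim (nr _ k lo≤v u≤hi (sym fu≡fv))

  windowInjective : {A : Set} (f : ℕ → A) (a e : ℕ) → NoRepeat f a (e + a) →
    ∀ {u v : Fin (suc e)} → f (toℕ u + a) ≡ f (toℕ v + a) → u ≡ v
  windowInjective f a e nr {u} {v} eq = FinP.toℕ-injective (ℕP.+-cancelʳ-≡ _ _ _
    (noRepeat⇒injective f nr (ℕP.m≤n+m a _) (ℕP.m≤n+m a _)
      (ℕP.+-monoˡ-≤ a (toℕ≤ u)) (ℕP.+-monoˡ-≤ a (toℕ≤ v)) eq))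

  noRepeat-shift : {A : Set} (f : ℕ → A) {lo hi : ℕ} → NoRepeat f (suc lo) (suc hi) →
    NoRepeat (λ t → f (suc t)) lo hi
  noRepeat-shift f {hi = hi} nr b k lo≤b bound eq =
    nr (suc b) k (s≤s lo≤b) (subst (_≤ suc hi) (sym (ℕP.+-suc (suc k) b)) (s≤s bound))
       (trans eq (cong f (sym (ℕP.+-suc (suc k) b))))

  cycleFromRowRepeat : ∀ {m n} {F : Fin m → Fin n → Set} (W : Walk F) (a e : ℕ) →
    let open Walk W in
    row a ≡ row (suc e + a) → NoRepeat row a (e + a) →
    NoRepeat row (suc a) (suc e + a) → NoRepeat col a (e + a) → Cycle F
  cycleFromRowRepeat {F = F} W a e repeat rowsR rowsR′ cols = record
    { L = e
    ; R = λ u → row (toℕ u + a)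
    ; R′ = λ u → row (suc (toℕ u + a))
    ; K = λ u → col (toℕ u + a)
    ; R-injective = windowInjective row a e rowsR
    ; R′-injective = windowInjective (λ t → row (suc t)) a e (noRepeat-shift row rowsR′)
    ; K-injective = windowInjective col a e cols
    ; R′≢R = λ u → row-moves (toℕ u + a)
    ; R′⊆R = R′⊆R
    ; R⊆R′ = R⊆R′
    ; edge = λ u → edge (toℕ u + a)
    ; edge′ = λ u → edge′ (toℕ u + a)
    }
    where
    open Walk W
    R′⊆R : ∀ (u : Fin (suc e)) → Σ (Fin (suc e)) λ v → row (toℕ v + a) ≡ row (suc (toℕ u + a))
    R′⊆R u with ℕP.m≤n⇒m<n∨m≡n (toℕ≤ u)
    ... | inj₁ u<e = Fin.fromℕ< (s≤s u<e) , cong (λ t → row (t + a)) (FinP.toℕ-fromℕ< (s≤s u<e))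
    ... | inj₂ u≡e = Fin.zero , trans repeat (cong (λ t → row (suc (t + a))) (sym u≡e))
    R⊆R′ : ∀ (u : Fin (suc e)) → Σ (Fin (suc e)) λ v → row (suc (toℕ v + a)) ≡ row (toℕ u + a)
    R⊆R′ Fin.zero = Fin.fromℕ e , trans (cong (λ t → row (suc (t + a))) (FinP.toℕ-fromℕ e)) (sym repeat)
    R⊆R′ (Fin.suc u) = Fin.inject₁ u , cong (λ t → row (suc (t + a))) (FinP.toℕ-inject₁ u)

  transposeWalk : ∀ {m n} {F : Fin m → Fin n → Set} → Walk F → Walk (flipRel F)
  transposeWalk W = record
    { row = col ; col = λ t → row (suc t)
    ; edge = edge′ ; edge′ = λ t → edge (suc t)
    ; row-moves = col-moves ; col-moves = λ t → row-moves (suc t) }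
    where open Walk W

  record ShortestRepeat {A B : Set} (m : ℕ) (r : ℕ → A) (c : ℕ → B) : Set where
    field
      start gap : ℕ
      inRange : suc gap + start ≤ m
      repeats : r start ≡ r (suc gap + start) ⊎ c start ≡ c (suc gap + start)
      distinctBelow : ∀ b k → k < gap → suc k + b ≤ m →
        r b ≢ r (suc k + b) × c b ≢ c (suc k + b)

  -- By pigeonhole, m + 1 values in Fin m repeat; a shortest repetition of
  -- either sequence is then found by bounded search.
  shortestRepeat : ∀ {m n} (r : ℕ → Fin m) (c : ℕ → Fin n) → ShortestRepeat m r c
  shortestRepeat {m} r c = record
    { start = toℕ (proj₁ least)
    ; gap = gap
    ; inRange = proj₁ (proj₂ least)
    ; repeats = proj₂ (proj₂ least)
    ; distinctBelow = distinctBelow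
    }
    where
    Repeat : ℕ → Set
    Repeat g = Σ (Fin (suc m)) λ b → (suc g + toℕ b ≤ m) ×
                 (r (toℕ b) ≡ r (suc g + toℕ b) ⊎ c (toℕ b) ≡ c (suc g + toℕ b))
    repeat? : ∀ g → Dec (Repeat g)
    repeat? g = FinP.any? λ b → (suc g + toℕ b ℕP.≤? m) ×-dec
                  ((r (toℕ b) FinP.≟ r (suc g + toℕ b)) ⊎-dec (c (toℕ b) FinP.≟ c (suc g + toℕ b)))
    someRepeat : Σ ℕ Repeat
    someRepeat with FinP.pigeonhole (ℕP.n<1+n m) (λ (t : Fin (suc m)) → r (toℕ t))
    ... | i , j , i<j , ri≡rj with <⇒suc+ i<j
    ...   | g , j≡ = g , i , subst (_≤ m) j≡ (toℕ≤ j) , inj₁ (trans ri≡rj (cong r j≡))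
    shortest : Σ ℕ λ g → Repeat g × (∀ d → d < g → ¬ Repeat d)
    shortest = leastWitness Repeat repeat? (proj₁ someRepeat) (proj₂ someRepeat)
    gap : ℕ
    gap = proj₁ shortest
    least : Repeat gap
    least = proj₁ (proj₂ shortest)
    distinctBelow : ∀ b k → k < gap → suc k + b ≤ m → r b ≢ r (suc k + b) × c b ≢ c (suc k + b)
    distinctBelow b k k<gap bound =
      (λ eq → proj₂ (proj₂ shortest) k k<gap (asRepeat (inj₁ eq))) ,
      (λ eq → proj₂ (proj₂ shortest) k k<gap (asRepeat (inj₂ eq)))
      where
      b<1+m : b < suc m
      b<1+m = s≤s (ℕP.≤-trans (ℕP.m≤n+m b (suc k)) bound)
      asRepeat : r b ≡ r (suc k + b) ⊎ c b ≡ c (suc k + b) → Repeat k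
      asRepeat rep = Fin.fromℕ< b<1+m ,
        subst (λ t → (suc k + t ≤ m) × (r t ≡ r (suc k + t) ⊎ c t ≡ c (suc k + t)))
              (sym (FinP.toℕ-fromℕ< b<1+m)) (bound , rep)

  -- Every infinite walk contains a cycle, of F itself or of its transpose
  -- (according as a row or a column repeats first).
  findCycle : ∀ {m n} {F : Fin m → Fin n → Set} → Walk F → Cycle F ⊎ Cycle (flipRel F)
  findCycle {m} {F = F} W = fromRepeat repeats
    where
    open Walk W
    open ShortestRepeat (shortestRepeat row col)
    window : {A : Set} (f : ℕ → A) → (∀ b k → k < gap → suc k + b ≤ m → f b ≢ f (suc k + b)) →
             ∀ lo hi → hi ≤ m → hi ≤ gap + lo → NoRepeat f lo hi
    window f distinct lo hi hi≤m hi≤gap+lo b k lo≤b bound = distinct b k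
      (ℕP.+-cancelʳ-≤ lo (suc k) gap
        (ℕP.≤-trans (ℕP.+-monoʳ-≤ (suc k) lo≤b) (ℕP.≤-trans bound hi≤gap+lo)))
      (ℕP.≤-trans bound hi≤m)
    shortEnd : gap + start ≤ m
    shortEnd = ℕP.≤-trans (ℕP.n≤1+n _) inRange
    longEnd : suc gap + start ≤ gap + suc start
    longEnd = ℕP.≤-reflexive (sym (ℕP.+-suc gap start))
    rows : NoRepeat row start (gap + start)
    rows = window row (λ b k lt bd → proj₁ (distinctBelow b k lt bd)) start (gap + start) shortEnd ℕP.≤-refl
    rows′ : NoRepeat row (suc start) (suc gap + start)
    rows′ = window row (λ b k lt bd → proj₁ (distinctBelow b k lt bd)) (suc start) (suc gap + start) inRange longEnd
    cols : NoRepeat col start (gap + start)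
    cols = window col (λ b k lt bd → proj₂ (distinctBelow b k lt bd)) start (gap + start) shortEnd ℕP.≤-refl
    cols′ : NoRepeat col (suc start) (suc gap + start)
    cols′ = window col (λ b k lt bd → proj₂ (distinctBelow b k lt bd)) (suc start) (suc gap + start) inRange longEnd
    fromRepeat : row start ≡ row (suc gap + start) ⊎ col start ≡ col (suc gap + start) →
                 Cycle F ⊎ Cycle (flipRel F)
    fromRepeat (inj₁ rowRepeat) = inj₁ (cycleFromRowRepeat W start gap rowRepeat rows rows′ cols)
    fromRepeat (inj₂ colRepeat) =
      inj₂ (cycleFromRowRepeat (transposeWalk W) start gap colRepeat cols cols′ (noRepeat-shift row rows′))

open WalksContainCycles using (findCycle)
open Rat using (_+_; _*_; _-_; -_; _≤_; _<_)
open +-*-Solver using (solve; _:+_; _:*_; _:-_; :-_; _:=_; con)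

ℤtoℚ-+ : ∀ a b → ℤtoℚ (a ℤ.+ b) ≡ ℤtoℚ a + ℤtoℚ b
ℤtoℚ-+ a b = trans (ℚP.fromℚᵘ-cong eq) (ℚP.fromℚᵘ-toℚᵘ (ℤtoℚ a + ℤtoℚ b))
  where
  eq : ℚᵘ.mkℚᵘ (a ℤ.+ b) 0 ℚᵘ.≃ ℚ.toℚᵘ (ℤtoℚ a + ℤtoℚ b)
  eq = ℚᵘP.≃-sym (ℚᵘP.≃-trans (ℚP.toℚᵘ-homo-+ (ℤtoℚ a) (ℤtoℚ b))
         (ℚᵘP.≃-trans (ℚᵘP.+-cong (ℚP.toℚᵘ-fromℚᵘ (ℚᵘ.mkℚᵘ a 0)) (ℚP.toℚᵘ-fromℚᵘ (ℚᵘ.mkℚᵘ b 0)))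
           (ℚᵘ.*≡* (cong₂ (λ u v → (u ℤ.+ v) ℤ.* + 1) (ℤP.*-identityʳ a) (ℤP.*-identityʳ b)))))

ℤtoℚ-injective : ∀ {a b} → ℤtoℚ a ≡ ℤtoℚ b → a ≡ b
ℤtoℚ-injective {a} {b} eq with ℚP.fromℚᵘ-injective {ℚᵘ.mkℚᵘ a 0} {ℚᵘ.mkℚᵘ b 0} eq
... | ℚᵘ.*≡* e = trans (sym (ℤP.*-identityʳ a)) (trans e (ℤP.*-identityʳ b))

ℕtoℚ-+ : ∀ a b → ℕtoℚ (a Nat.+ b) ≡ ℕtoℚ a + ℕtoℚ b
ℕtoℚ-+ a b = ℤtoℚ-+ (+ a) (+ b)

ℕtoℚ-nonneg : ∀ k → 0ℚ ≤ ℕtoℚ k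
ℕtoℚ-nonneg k = ℚP.nonNegative⁻¹ _ {{ℚP.normalize-nonNeg k 1}}

ℕtoℚ-mono : ∀ {a b} → a Nat.≤ b → ℕtoℚ a ≤ ℕtoℚ b
ℕtoℚ-mono {a} le with ℕP.m≤n⇒∃[o]m+o≡n le
... | k , refl = subst (_≤ ℕtoℚ (a Nat.+ k)) (ℚP.+-identityʳ (ℕtoℚ a))
                   (subst (ℕtoℚ a + 0ℚ ≤_) (sym (ℕtoℚ-+ a k))
                     (ℚP.+-monoʳ-≤ (ℕtoℚ a) (ℕtoℚ-nonneg k)))

ℕtoℚ-<-reflect : ∀ {a b} → ℕtoℚ a < ℕtoℚ b → a Nat.< b
ℕtoℚ-<-reflect {a} {b} lt with ℕP.<-cmp a b
... | tri< a<b _ _ = a<b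
... | tri≈ _ refl _ = ⊥-elim (ℚP.<-irrefl refl lt)
... | tri> _ _ b<a = ⊥-elim (ℚP.<-irrefl refl (ℚP.<-≤-trans lt (ℕtoℚ-mono (ℕP.<⇒≤ b<a))))

sumℚ-cong : ∀ n {f g : Fin n → ℚ} → (∀ i → f i ≡ g i) → sumℚ n f ≡ sumℚ n g
sumℚ-cong zero eq = refl
sumℚ-cong (suc n) eq = cong₂ _+_ (eq Fin.zero) (sumℚ-cong n (λ i → eq (Fin.suc i)))

sumℚ-+ : ∀ n (f g : Fin n → ℚ) → sumℚ n (λ i → f i + g i) ≡ sumℚ n f + sumℚ n g
sumℚ-+ zero f g = refl
sumℚ-+ (suc n) f g = trans (cong (λ s → (f Fin.zero + g Fin.zero) + s) (sumℚ-+ n _ _))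
  (solve 4 (λ a b c d → (a :+ b) :+ (c :+ d) := (a :+ c) :+ (b :+ d)) refl
    (f Fin.zero) (g Fin.zero) (sumℚ n (λ i → f (Fin.suc i))) (sumℚ n (λ i → g (Fin.suc i))))

sumℚ-scale : ∀ n (c : ℚ) (f : Fin n → ℚ) → sumℚ n (λ i → c * f i) ≡ c * sumℚ n f
sumℚ-scale zero c f = sym (ℚP.*-zeroʳ c)
sumℚ-scale (suc n) c f = trans (cong (λ s → c * f Fin.zero + s) (sumℚ-scale n c _))
  (sym (ℚP.*-distribˡ-+ c (f Fin.zero) _))

sumℚ-zero : ∀ n → sumℚ n (λ _ → 0ℚ) ≡ 0ℚ
sumℚ-zero zero = refl
sumℚ-zero (suc n) = trans (ℚP.+-identityˡ _) (sumℚ-zero n)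

sumℚ-neg : ∀ n (f : Fin n → ℚ) → sumℚ n (λ i → - f i) ≡ - sumℚ n f
sumℚ-neg zero f = refl
sumℚ-neg (suc n) f = trans (cong (λ s → - f Fin.zero + s) (sumℚ-neg n _))
  (sym (ℚP.neg-distrib-+ (f Fin.zero) _))

sumℚ-− : ∀ n (f g : Fin n → ℚ) → sumℚ n (λ i → f i - g i) ≡ sumℚ n f - sumℚ n g
sumℚ-− n f g = trans (sumℚ-+ n f (λ i → - g i)) (cong (λ s → sumℚ n f + s) (sumℚ-neg n g))

sumℚ-nonneg : ∀ n (f : Fin n → ℚ) → (∀ i → 0ℚ ≤ f i) → 0ℚ ≤ sumℚ n f
sumℚ-nonneg zero f f≥0 = ℚP.≤-refl
sumℚ-nonneg (suc n) f f≥0 = ℚP.+-mono-≤ (f≥0 Fin.zero) (sumℚ-nonneg n _ (λ i → f≥0 (Fin.suc i)))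

≤-+ˡ : ∀ a {b} → 0ℚ ≤ b → a ≤ b + a
≤-+ˡ a {b} b≥0 = subst (_≤ b + a) (ℚP.+-identityˡ a) (ℚP.+-monoˡ-≤ a b≥0)

≤-+ʳ : ∀ a {b} → 0ℚ ≤ b → a ≤ a + b
≤-+ʳ a {b} b≥0 = subst (_≤ a + b) (ℚP.+-identityʳ a) (ℚP.+-monoʳ-≤ a b≥0)

term≤sumℚ : ∀ n (f : Fin n → ℚ) → (∀ i → 0ℚ ≤ f i) → ∀ a → f a ≤ sumℚ n f
term≤sumℚ (suc n) f f≥0 Fin.zero = ≤-+ʳ (f Fin.zero) (sumℚ-nonneg n _ (λ i → f≥0 (Fin.suc i)))
term≤sumℚ (suc n) f f≥0 (Fin.suc a) =
  ℚP.≤-trans (term≤sumℚ n _ (λ i → f≥0 (Fin.suc i)) a) (≤-+ˡ _ (f≥0 Fin.zero))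

twoTerms≤sumℚ : ∀ n (f : Fin n → ℚ) → (∀ i → 0ℚ ≤ f i) → ∀ a b → a ≢ b → f a + f b ≤ sumℚ n f
twoTerms≤sumℚ (suc n) f f≥0 Fin.zero Fin.zero a≢b = ⊥-elim (a≢b refl)
twoTerms≤sumℚ (suc n) f f≥0 Fin.zero (Fin.suc b) _ =
  ℚP.+-monoʳ-≤ (f Fin.zero) (term≤sumℚ n _ (λ i → f≥0 (Fin.suc i)) b)
twoTerms≤sumℚ (suc n) f f≥0 (Fin.suc a) Fin.zero _ =
  subst (_≤ sumℚ (suc n) f) (ℚP.+-comm (f Fin.zero) (f (Fin.suc a)))
    (ℚP.+-monoʳ-≤ (f Fin.zero) (term≤sumℚ n _ (λ i → f≥0 (Fin.suc i)) a))
twoTerms≤sumℚ (suc n) f f≥0 (Fin.suc a) (Fin.suc b) a≢b =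
  ℚP.≤-trans (twoTerms≤sumℚ n _ (λ i → f≥0 (Fin.suc i)) a b (λ e → a≢b (cong Fin.suc e)))
             (≤-+ˡ _ (f≥0 Fin.zero))

sumℚ-single : ∀ n (f : Fin n → ℚ) a → (∀ i → i ≢ a → f i ≡ 0ℚ) → sumℚ n f ≡ f a
sumℚ-single (suc n) f Fin.zero others =
  trans (cong (λ s → f Fin.zero + s) (trans (sumℚ-cong n (λ i → others (Fin.suc i) (λ ()))) (sumℚ-zero n)))
        (ℚP.+-identityʳ _)
sumℚ-single (suc n) f (Fin.suc a) others =
  trans (cong (_+ sumℚ n (λ i → f (Fin.suc i))) (others Fin.zero (λ ())))
    (trans (ℚP.+-identityˡ _)
      (sumℚ-single n _ a (λ i i≢a → others (Fin.suc i) (λ e → i≢a (FinP.suc-injective e)))))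

ℤtoℚ-sumℤ : ∀ n (f : Fin n → ℤ) → ℤtoℚ (sumℤ n f) ≡ sumℚ n (λ i → ℤtoℚ (f i))
ℤtoℚ-sumℤ zero f = refl
ℤtoℚ-sumℤ (suc n) f = trans (ℤtoℚ-+ (f Fin.zero) (sumℤ n (λ i → f (Fin.suc i))))
  (cong (λ s → ℤtoℚ (f Fin.zero) + s) (ℤtoℚ-sumℤ n (λ i → f (Fin.suc i))))

indicator : {P : Set} → Dec P → ℚ
indicator (yes _) = 1ℚ
indicator (no _) = 0ℚ

indicator-iff : ∀ {P Q : Set} (P? : Dec P) (Q? : Dec Q) → (P → Q) → (Q → P) → indicator P? ≡ indicator Q?
indicator-iff (yes p) (yes q) _ _ = refl
indicator-iff (yes p) (no ¬q) f _ = ⊥-elim (¬q (f p))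
indicator-iff (no ¬p) (yes q) _ g = ⊥-elim (¬p (g q))
indicator-iff (no ¬p) (no ¬q) _ _ = refl

sumℚ-indicator : ∀ q {P : Fin q → Set} (P? : ∀ b → Dec (P b)) {Q : Set} (Q? : Dec Q) →
  (Q → Σ (Fin q) λ b₀ → P b₀ × (∀ b → P b → b ≡ b₀)) → (¬ Q → ∀ b → ¬ P b) →
  sumℚ q (λ b → indicator (P? b)) ≡ indicator Q?
sumℚ-indicator q P? (yes holds) unique _ with unique holds
... | b₀ , pb₀ , only = trans (sumℚ-single q _ b₀ vanish) (atWitness (P? b₀))
  where
  vanish : ∀ b → b ≢ b₀ → indicator (P? b) ≡ 0ℚ
  vanish b b≢b₀ with P? b
  ... | yes pb = ⊥-elim (b≢b₀ (only b pb))
  ... | no _ = refl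
  atWitness : (d : Dec _) → indicator d ≡ 1ℚ
  atWitness (yes _) = refl
  atWitness (no ¬pb₀) = ⊥-elim (¬pb₀ pb₀)
sumℚ-indicator q P? (no ¬holds) _ nowhere = trans (sumℚ-cong q vanish) (sumℚ-zero q)
  where
  vanish : ∀ b → indicator (P? b) ≡ 0ℚ
  vanish b with P? b
  ... | yes pb = ⊥-elim (nowhere ¬holds b pb)
  ... | no _ = refl

argmin : ∀ L (f : Fin (suc L) → ℚ) → Σ (Fin (suc L)) λ u₀ → ∀ u → f u₀ ≤ f u
argmin zero f = Fin.zero , λ { Fin.zero → ℚP.≤-refl }
argmin (suc L) f with argmin L (λ u → f (Fin.suc u))
... | u₁ , min₁ with f Fin.zero ℚ.≤? f (Fin.suc u₁)
...   | yes le = Fin.zero , λ { Fin.zero → ℚP.≤-refl ; (Fin.suc u) → ℚP.≤-trans le (min₁ u) }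
...   | no nle = Fin.suc u₁ , λ { Fin.zero → ℚP.<⇒≤ (ℚP.≰⇒> nle) ; (Fin.suc u) → min₁ u }

rowSum : {m n : ℕ} → Matℚ m n → Fin m → ℚ
rowSum {n = n} X i = sumℚ n (λ j → X i j)

colSum : {m n : ℕ} → Matℚ m n → Fin n → ℚ
colSum {m = m} X j = sumℚ m (λ i → X i j)

transpose : {m n : ℕ} → Matℚ m n → Matℚ n m
transpose X j i = X i j

SameMargins : {m n : ℕ} → Matℚ m n → Matℚ m n → Set
SameMargins X Y = (∀ i → rowSum Y i ≡ rowSum X i) × (∀ j → colSum Y j ≡ colSum X j)

SmallerSupport : {m n : ℕ} → Matℚ m n → Matℚ m n → Set
SmallerSupport {m} {n} X Y =
  (∀ i j → X i j ≡ 0ℚ → Y i j ≡ 0ℚ) × (Σ (Fin m) λ i → Σ (Fin n) λ j → (X i j ≢ 0ℚ) × (Y i j ≡ 0ℚ))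

record Piece {m n : ℕ} (X : Matℚ m n) : Set where
  field
    matrix : Matℚ m n
    nonneg : Nonneg matrix
    sameMargins : SameMargins X matrix
    smaller : SmallerSupport X matrix

record Split {m n : ℕ} (X : Matℚ m n) : Set where
  field
    t w : ℚ
    t≥0 : 0ℚ ≤ t
    w≥0 : 0ℚ ≤ w
    t+w≡1 : t + w ≡ 1ℚ
    first second : Piece X
    combination : ∀ i j → X i j ≡ t * Piece.matrix first i j + w * Piece.matrix second i j

transposePiece : ∀ {m n} {X : Matℚ m n} → Piece (transpose X) → Piece X
transposePiece P = record
  { matrix = transpose matrix
  ; nonneg = λ i j → nonneg j i
  ; sameMargins = proj₂ sameMargins , proj₁ sameMargins
  ; smaller = (λ i j → proj₁ smaller j i) ,
              (proj₁ (proj₂ (proj₂ smaller)) , proj₁ (proj₂ smaller) , proj₂ (proj₂ (proj₂ smaller)))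
  }
  where open Piece P

transposeSplit : ∀ {m n} {X : Matℚ m n} → Split (transpose X) → Split X
transposeSplit S = record
  { t = t ; w = w ; t≥0 = t≥0 ; w≥0 = w≥0 ; t+w≡1 = t+w≡1
  ; first = transposePiece first ; second = transposePiece second
  ; combination = λ i j → combination j i
  }
  where open Split S

module CycleMatrix {m n : ℕ} {F : Fin m → Fin n → Set} (cyc : Cycle F) where
  open Cycle cyc

  OnCells : (Fin (suc L) → Fin m) → Fin m → Fin n → Set
  OnCells S i j = Σ (Fin (suc L)) λ u → (S u ≡ i) × (K u ≡ j)

  onCells? : ∀ S i j → Dec (OnCells S i j)
  onCells? S i j = FinP.any? (λ u → (S u FinP.≟ i) ×-dec (K u FinP.≟ j))

  cycleMatrix : Matℚ m n
  cycleMatrix i j = indicator (onCells? R i j) - indicator (onCells? R′ i j)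

  -- each column of the cycle meets S exactly once, since K is injective
  colCount : ∀ S j → sumℚ m (λ i → indicator (onCells? S i j)) ≡ indicator (FinP.any? (λ u → K u FinP.≟ j))
  colCount S j = sumℚ-indicator m (λ i → onCells? S i j) (FinP.any? (λ u → K u FinP.≟ j))
    (λ { (u₀ , Ku₀≡j) → S u₀ , (u₀ , refl , Ku₀≡j) ,
           λ { i (u , Su≡i , Ku≡j) → trans (sym Su≡i) (cong S (K-injective (trans Ku≡j (sym Ku₀≡j)))) } })
    (λ { noCol i (u , _ , Ku≡j) → noCol (u , Ku≡j) })

  rowCount : ∀ S → (∀ {u v} → S u ≡ S v → u ≡ v) → ∀ i →
    sumℚ n (λ j → indicator (onCells? S i j)) ≡ indicator (FinP.any? (λ u → S u FinP.≟ i))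
  rowCount S S-injective i = sumℚ-indicator n (λ j → onCells? S i j) (FinP.any? (λ u → S u FinP.≟ i))
    (λ { (u₀ , Su₀≡i) → K u₀ , (u₀ , Su₀≡i , refl) ,
           λ { j (u , Su≡i , Ku≡j) → trans (sym Ku≡j) (cong K (S-injective (trans Su≡i (sym Su₀≡i)))) } })
    (λ { noRow j (u , Su≡i , _) → noRow (u , Su≡i) })

  cycleMatrix-colSum : ∀ j → colSum cycleMatrix j ≡ 0ℚ
  cycleMatrix-colSum j = begin
    colSum cycleMatrix j                                     ≡⟨ sumℚ-− m _ _ ⟩
    sumℚ m (λ i → indicator (onCells? R i j)) - sumℚ m (λ i → indicator (onCells? R′ i j))
                                                             ≡⟨ cong₂ _-_ (colCount R j) (colCount R′ j) ⟩
    column - column                                          ≡⟨ ℚP.+-inverseʳ column ⟩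
    0ℚ                                                       ∎
    where
    open ≡-Reasoning
    column : ℚ
    column = indicator (FinP.any? (λ u → K u FinP.≟ j))

  cycleMatrix-rowSum : ∀ i → rowSum cycleMatrix i ≡ 0ℚ
  cycleMatrix-rowSum i = begin
    rowSum cycleMatrix i                                     ≡⟨ sumℚ-− n _ _ ⟩
    sumℚ n (λ j → indicator (onCells? R i j)) - sumℚ n (λ j → indicator (onCells? R′ i j))
                                                             ≡⟨ cong₂ _-_ (rowCount R R-injective i) (rowCount R′ R′-injective i) ⟩
    inR - indicator (FinP.any? (λ u → R′ u FinP.≟ i))        ≡⟨ cong (λ s → inR - s) sameRows ⟩
    inR - inR                                                ≡⟨ ℚP.+-inverseʳ inR ⟩
    0ℚ                                                       ∎
    where
    open ≡-Reasoning
    inR : ℚ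
    inR = indicator (FinP.any? (λ u → R u FinP.≟ i))
    -- R and R′ have the same image
    sameRows : indicator (FinP.any? (λ u → R′ u FinP.≟ i)) ≡ inR
    sameRows = indicator-iff (FinP.any? (λ u → R′ u FinP.≟ i)) (FinP.any? (λ u → R u FinP.≟ i))
      (λ { (u , R′u≡i) → proj₁ (R′⊆R u) , trans (proj₂ (R′⊆R u)) R′u≡i })
      (λ { (u , Ru≡i) → proj₁ (R⊆R′ u) , trans (proj₂ (R⊆R′ u)) Ru≡i })

  disjoint : ∀ {i j} → OnCells R i j → OnCells R′ i j → ⊥
  disjoint (u , Ru≡i , Ku≡j) (v , R′v≡i , Kv≡j) =
    R′≢R v (trans R′v≡i (trans (sym Ru≡i) (cong R (K-injective (trans Ku≡j (sym Kv≡j))))))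

  data Side (i : Fin m) (j : Fin n) : ℚ → Set where
    onR : OnCells R i j → Side i j 1ℚ
    onR′ : OnCells R′ i j → Side i j (- 1ℚ)
    off : ¬ OnCells R i j → ¬ OnCells R′ i j → Side i j 0ℚ

  side : ∀ i j → Side i j (cycleMatrix i j)
  side i j = classify (onCells? R i j) (onCells? R′ i j)
    where
    classify : (p : Dec (OnCells R i j)) (q : Dec (OnCells R′ i j)) → Side i j (indicator p - indicator q)
    classify (yes p) (yes q) = ⊥-elim (disjoint p q)
    classify (yes p) (no _) = onR p
    classify (no _) (yes q) = onR′ q
    classify (no ¬p) (no ¬q) = off ¬p ¬q

  perturb : Matℚ m n → ℚ → Matℚ m n
  perturb X c i j = X i j + c * cycleMatrix i j

  perturb-sameMargins : ∀ X c → SameMargins X (perturb X c)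
  perturb-sameMargins X c =
    (λ i → trans (sumℚ-+ n _ _) (vanishing (rowSum X i) (sumℚ-scale n c _) (cycleMatrix-rowSum i))) ,
    (λ j → trans (sumℚ-+ m _ _) (vanishing (colSum X j) (sumℚ-scale m c _) (cycleMatrix-colSum j)))
    where
    vanishing : ∀ s {t u} → t ≡ c * u → u ≡ 0ℚ → s + t ≡ s
    vanishing s t≡cu u≡0 = trans (cong (λ t → s + t) (trans t≡cu (trans (cong (c *_) u≡0) (ℚP.*-zeroʳ c))))
                                 (ℚP.+-identityʳ s)

  +c*1 : ∀ x c → x + c * 1ℚ ≡ x + c
  +c*1 = solve 2 (λ x c → x :+ c :* con 1ℚ := x :+ c) refl

  +c*-1 : ∀ x c → x + c * (- 1ℚ) ≡ x - c
  +c*-1 = solve 2 (λ x c → x :+ c :* (:- con 1ℚ) := x :- c) refl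

  +c*0 : ∀ x c → x + c * 0ℚ ≡ x
  +c*0 = solve 2 (λ x c → x :+ c :* con 0ℚ := x) refl

  perturb-nonneg : ∀ X c → Nonneg X → (∀ u → 0ℚ ≤ X (R u) (K u) + c) →
                   (∀ u → 0ℚ ≤ X (R′ u) (K u) - c) → Nonneg (perturb X c)
  perturb-nonneg X c X≥0 addR subR′ i j = atSide (side i j)
    where
    atSide : ∀ {i j v} → Side i j v → 0ℚ ≤ X i j + c * v
    atSide (onR (u , refl , refl)) = subst (0ℚ ≤_) (sym (+c*1 (X (R u) (K u)) c)) (addR u)
    atSide (onR′ (u , refl , refl)) = subst (0ℚ ≤_) (sym (+c*-1 (X (R′ u) (K u)) c)) (subR′ u)
    atSide {i} {j} (off _ _) = subst (0ℚ ≤_) (sym (+c*0 (X i j) c)) (X≥0 i j)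

  perturb-zeros : ∀ X c → (∀ u → X (R u) (K u) ≢ 0ℚ) → (∀ u → X (R′ u) (K u) ≢ 0ℚ) →
                  ∀ i j → X i j ≡ 0ℚ → perturb X c i j ≡ 0ℚ
  perturb-zeros X c nzR nzR′ i j Xij≡0 = atSide (side i j) Xij≡0
    where
    atSide : ∀ {i j v} → Side i j v → X i j ≡ 0ℚ → X i j + c * v ≡ 0ℚ
    atSide (onR (u , refl , refl)) X≡0 = ⊥-elim (nzR u X≡0)
    atSide (onR′ (u , refl , refl)) X≡0 = ⊥-elim (nzR′ u X≡0)
    atSide {i} {j} (off _ _) X≡0 = trans (+c*0 (X i j) c) X≡0

  perturb-atR : ∀ X c u → perturb X c (R u) (K u) ≡ X (R u) (K u) + c
  perturb-atR X c u = atSide (side (R u) (K u))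
    where
    atSide : ∀ {v} → Side (R u) (K u) v → X (R u) (K u) + c * v ≡ X (R u) (K u) + c
    atSide (onR _) = +c*1 (X (R u) (K u)) c
    atSide (onR′ q) = ⊥-elim (disjoint (u , refl , refl) q)
    atSide (off ¬p _) = ⊥-elim (¬p (u , refl , refl))

  perturb-atR′ : ∀ X c u → perturb X c (R′ u) (K u) ≡ X (R′ u) (K u) - c
  perturb-atR′ X c u = atSide (side (R′ u) (K u))
    where
    atSide : ∀ {v} → Side (R′ u) (K u) v → X (R′ u) (K u) + c * v ≡ X (R′ u) (K u) - c
    atSide (onR p) = ⊥-elim (disjoint p (u , refl , refl))
    atSide (onR′ _) = +c*-1 (X (R′ u) (K u)) c
    atSide (off _ ¬q) = ⊥-elim (¬q (u , refl , refl))

0≤* : ∀ {a b} → 0ℚ ≤ a → 0ℚ ≤ b → 0ℚ ≤ a * b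
0≤* {a} {b} a≥0 b≥0 = subst (_≤ a * b) (ℚP.*-zeroˡ b) (ℚP.*-monoʳ-≤-nonNeg b {{ℚ.nonNegative b≥0}} a≥0)

0≤− : ∀ {a x} → a ≤ x → 0ℚ ≤ x - a
0≤− {a} {x} a≤x = subst (_≤ x - a) (ℚP.+-inverseʳ a) (ℚP.+-monoˡ-≤ (- a) a≤x)

-- Cancelling a cycle of positive cells of a nonnegative X: with α (β) the
-- least entry of X on the R′-cells (R-cells) and C the cycle matrix,
--   X = β/(α+β) · (X + αC) + α/(α+β) · (X − βC),
-- both matrices are nonnegative with the margins of X, and each has a new
-- zero where the minimum was attained.
cycleSplit : ∀ {m n} (X : Matℚ m n) → Nonneg X → {F : Fin m → Fin n → Set} →
             (∀ {i j} → F i j → 0ℚ < X i j) → Cycle F → Split X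
cycleSplit X X≥0 positive cyc = record
  { t = β * s ; w = α * s
  ; t≥0 = 0≤* (ℚP.<⇒≤ β>0) s≥0 ; w≥0 = 0≤* (ℚP.<⇒≤ α>0) s≥0
  ; t+w≡1 = begin
      β * s + α * s ≡⟨ ℚP.*-distribʳ-+ s β α ⟨
      (β + α) * s   ≡⟨ cong (_* s) (ℚP.+-comm β α) ⟩
      (α + β) * s   ≡⟨ ℚP.*-inverseʳ (α + β) {{α+β≢0}} ⟩
      1ℚ            ∎
  ; first = record
      { matrix = perturb X α
      ; nonneg = perturb-nonneg X α X≥0 (λ u → ℚP.+-mono-≤ (X≥0 (R u) (K u)) (ℚP.<⇒≤ α>0))
                   (λ u → 0≤− (proj₂ minR′ u))
      ; sameMargins = perturb-sameMargins X α
      ; smaller = perturb-zeros X α nonzeroR nonzeroR′ ,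
                  R′ u₀ , K u₀ , nonzeroR′ u₀ , trans (perturb-atR′ X α u₀) (ℚP.+-inverseʳ α)
      }
  ; second = record
      { matrix = perturb X (- β)
      ; nonneg = perturb-nonneg X (- β) X≥0 (λ u → 0≤− (proj₂ minR u))
                   (λ u → subst (0ℚ ≤_) (x+β≡x-−β (X (R′ u) (K u)))
                                (ℚP.+-mono-≤ (X≥0 (R′ u) (K u)) (ℚP.<⇒≤ β>0)))
      ; sameMargins = perturb-sameMargins X (- β)
      ; smaller = perturb-zeros X (- β) nonzeroR nonzeroR′ ,
                  R v₀ , K v₀ , nonzeroR v₀ , trans (perturb-atR X (- β) v₀) (ℚP.+-inverseʳ β)
      }
  ; combination = λ i j → sym (begin
      β * s * perturb X α i j + α * s * perturb X (- β) i j
        ≡⟨ recombine β s (X i j) α (cycleMatrix i j) ⟩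
      (α + β) * s * X i j
        ≡⟨ cong (_* X i j) (ℚP.*-inverseʳ (α + β) {{α+β≢0}}) ⟩
      1ℚ * X i j
        ≡⟨ ℚP.*-identityˡ (X i j) ⟩
      X i j ∎)
  }
  where
  open Cycle cyc
  open CycleMatrix cyc
  open ≡-Reasoning
  minR′ : Σ (Fin (suc L)) λ u₀ → ∀ u → X (R′ u₀) (K u₀) ≤ X (R′ u) (K u)
  minR′ = argmin L (λ u → X (R′ u) (K u))
  minR : Σ (Fin (suc L)) λ v₀ → ∀ u → X (R v₀) (K v₀) ≤ X (R u) (K u)
  minR = argmin L (λ u → X (R u) (K u))
  u₀ v₀ : Fin (suc L)
  u₀ = proj₁ minR′
  v₀ = proj₁ minR
  α β : ℚ
  α = X (R′ u₀) (K u₀)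
  β = X (R v₀) (K v₀)
  α>0 : 0ℚ < α
  α>0 = positive (edge′ u₀)
  β>0 : 0ℚ < β
  β>0 = positive (edge v₀)
  α+β≢0 : ℚ.NonZero (α + β)
  α+β≢0 = ℚP.pos⇒nonZero (α + β) {{ℚ.positive (ℚP.+-mono-< α>0 β>0)}}
  s : ℚ
  s = (ℚ.1/ (α + β)) {{α+β≢0}}
  s≥0 : 0ℚ ≤ s
  s≥0 = ℚP.<⇒≤ (ℚP.positive⁻¹ s {{ℚP.1/pos⇒pos (α + β) {{ℚ.positive (ℚP.+-mono-< α>0 β>0)}}}})
  nonzeroR : ∀ u → X (R u) (K u) ≢ 0ℚ
  nonzeroR u X≡0 = ℚP.<-irrefl (sym X≡0) (positive (edge u))
  nonzeroR′ : ∀ u → X (R′ u) (K u) ≢ 0ℚ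
  nonzeroR′ u X≡0 = ℚP.<-irrefl (sym X≡0) (positive (edge′ u))
  x+β≡x-−β : ∀ x → x + β ≡ x - (- β)
  x+β≡x-−β x = solve 2 (λ x b → x :+ b := x :- (:- b)) refl x β
  recombine : ∀ b s x a c → b * s * (x + a * c) + a * s * (x + (- b) * c) ≡ (a + b) * s * x
  recombine = solve 5 (λ b s x a c → b :* s :* (x :+ a :* c) :+ a :* s :* (x :+ (:- b) :* c)
                                     := (a :+ b) :* s :* x) refl

ZeroOne : ℚ → Set
ZeroOne x = (x ≡ 0ℚ) ⊎ (x ≡ 1ℚ)

StrictlyBetween01 : ℚ → Set
StrictlyBetween01 x = (0ℚ < x) × (x < 1ℚ)

ZeroOne? : ∀ x → Dec (ZeroOne x)
ZeroOne? x = (x ℚP.≟ 0ℚ) ⊎-dec (x ℚP.≟ 1ℚ)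

trichotomy01 : ∀ {x} → 0ℚ ≤ x → x ≤ 1ℚ → ¬ ZeroOne x → StrictlyBetween01 x
trichotomy01 {x} x≥0 x≤1 notZeroOne with ℚP.<-cmp x 0ℚ | ℚP.<-cmp x 1ℚ
... | tri< x<0 _ _ | _ = ⊥-elim (ℚP.<-irrefl refl (ℚP.<-≤-trans x<0 x≥0))
... | tri≈ _ x≡0 _ | _ = ⊥-elim (notZeroOne (inj₁ x≡0))
... | tri> _ _ _ | tri≈ _ x≡1 _ = ⊥-elim (notZeroOne (inj₂ x≡1))
... | tri> _ _ _ | tri> _ _ x>1 = ⊥-elim (ℚP.<-irrefl refl (ℚP.<-≤-trans x>1 x≤1))
... | tri> _ _ x>0 | tri< x<1 _ _ = x>0 , x<1

natural-not-between : ∀ k N x → ℕtoℚ k ≡ x + ℕtoℚ N → ¬ StrictlyBetween01 x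
natural-not-between k N x k≡x+N (x>0 , x<1) = ℕP.<⇒≱ N<k (Nat.s≤s⁻¹ k<1+N)
  where
  N<k : N Nat.< k
  N<k = ℕtoℚ-<-reflect (subst (ℕtoℚ N <_) (sym k≡x+N)
          (subst (_< x + ℕtoℚ N) (ℚP.+-identityˡ (ℕtoℚ N)) (ℚP.+-monoˡ-< (ℕtoℚ N) x>0)))
  k<1+N : k Nat.< suc N
  k<1+N = ℕtoℚ-<-reflect (subst (ℕtoℚ k <_) (sym (ℕtoℚ-+ 1 N))
            (subst (_< 1ℚ + ℕtoℚ N) (sym k≡x+N) (ℚP.+-monoˡ-< (ℕtoℚ N) x<1)))

sumℚ-zeroOne : ∀ n (f : Fin n → ℚ) → (∀ j → ZeroOne (f j)) → Σ ℕ λ N → sumℚ n f ≡ ℕtoℚ N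
sumℚ-zeroOne zero f _ = 0 , refl
sumℚ-zeroOne (suc n) f f01 with sumℚ-zeroOne n (λ j → f (Fin.suc j)) (λ j → f01 (Fin.suc j)) | f01 Fin.zero
... | N , sum≡N | inj₁ f₀≡0 = N , trans (cong₂ _+_ f₀≡0 sum≡N) (ℚP.+-identityˡ _)
... | N , sum≡N | inj₂ f₀≡1 = suc N , trans (cong₂ _+_ f₀≡1 sum≡N) (sym (ℕtoℚ-+ 1 N))

sumℚ-zeroOne-except : ∀ n (f : Fin n → ℚ) a → (∀ j → j ≢ a → ZeroOne (f j)) →
                      Σ ℕ λ N → sumℚ n f ≡ f a + ℕtoℚ N
sumℚ-zeroOne-except (suc n) f Fin.zero f01 with sumℚ-zeroOne n (λ j → f (Fin.suc j)) (λ j → f01 (Fin.suc j) (λ ()))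
... | N , sum≡N = N , cong (λ s → f Fin.zero + s) sum≡N
sumℚ-zeroOne-except (suc n) f (Fin.suc a) f01
  with sumℚ-zeroOne-except n (λ j → f (Fin.suc j)) a (λ j j≢a → f01 (Fin.suc j) (λ e → j≢a (FinP.suc-injective e)))
     | f01 Fin.zero (λ ())
... | N , sum≡ | inj₁ f₀≡0 = N , trans (cong₂ _+_ f₀≡0 sum≡) (ℚP.+-identityˡ _)
... | N , sum≡ | inj₂ f₀≡1 = suc N , trans (cong₂ _+_ f₀≡1 sum≡)
        (trans (solve 3 (λ o p q → o :+ (p :+ q) := p :+ (o :+ q)) refl 1ℚ (f (Fin.suc a)) (ℕtoℚ N))
               (cong (λ s → f (Fin.suc a) + s) (sym (ℕtoℚ-+ 1 N))))

module IntegerMargins {m n : ℕ} (y : Fin m → ℕ) (z : Fin n → ℕ) (z≤1 : ∀ j → z j Nat.≤ 1) where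

  Transport : Matℚ m n → Set
  Transport = InTransport m n (λ i → ℕtoℚ (y i)) (λ j → ℕtoℚ (z j))

  Fractional : Matℚ m n → Fin m → Fin n → Set
  Fractional X i j = StrictlyBetween01 (X i j)

  module FractionalCells (X : Matℚ m n) (tr : Transport X) where
    X≥0 : Nonneg X
    X≥0 = proj₁ tr

    colSum≤1 : ∀ j → colSum X j ≤ 1ℚ
    colSum≤1 j = subst (_≤ 1ℚ) (sym (proj₂ (proj₂ tr) j)) (ℕtoℚ-mono (z≤1 j))

    entry≤1 : ∀ i j → X i j ≤ 1ℚ
    entry≤1 i j = ℚP.≤-trans (term≤sumℚ m (λ i → X i j) (λ i → X≥0 i j) i) (colSum≤1 j)

    -- A fractional cell is not alone in its column: otherwise the column
    -- sum, a natural number, would equal the fractional entry.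
    otherInColumn : ∀ i j → Fractional X i j → Σ (Fin m) λ i′ → (i′ ≢ i) × Fractional X i′ j
    otherInColumn i j (Xij>0 , Xij<1) with FinP.any? (λ i′ → ¬? (i′ FinP.≟ i) ×-dec (0ℚ ℚP.<? X i′ j))
    ... | yes (i′ , i′≢i , Xi′j>0) = i′ , i′≢i , Xi′j>0 , Xi′j<1
      where
      Xi′j<1 : X i′ j < 1ℚ
      Xi′j<1 = ℚP.<-≤-trans (subst (_< X i j + X i′ j) (ℚP.+-identityˡ (X i′ j)) (ℚP.+-monoˡ-< (X i′ j) Xij>0))
                 (ℚP.≤-trans (twoTerms≤sumℚ m (λ i → X i j) (λ i → X≥0 i j) i i′ (λ e → i′≢i (sym e)))
                             (colSum≤1 j))
    ... | no noOther = ⊥-elim (natural-not-between (z j) 0 (X i j) zj≡Xij (Xij>0 , Xij<1))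
      where
      vanish : ∀ i′ → i′ ≢ i → X i′ j ≡ 0ℚ
      vanish i′ i′≢i = ℚP.≤-antisym (ℚP.≮⇒≥ (λ Xi′j>0 → noOther (i′ , i′≢i , Xi′j>0))) (X≥0 i′ j)
      zj≡Xij : ℕtoℚ (z j) ≡ X i j + 0ℚ
      zj≡Xij = trans (sym (proj₂ (proj₂ tr) j))
                 (trans (sumℚ-single m (λ i → X i j) i vanish) (sym (ℚP.+-identityʳ (X i j))))

    -- A fractional cell is not alone in its row: otherwise the row sum,
    -- a natural number, would be the fractional entry plus a natural number.
    otherInRow : ∀ i j → Fractional X i j → Σ (Fin n) λ j′ → (j′ ≢ j) × Fractional X i j′
    otherInRow i j frac with FinP.any? (λ j′ → ¬? (j′ FinP.≟ j) ×-dec ((0ℚ ℚP.<? X i j′) ×-dec (X i j′ ℚP.<? 1ℚ)))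
    ... | yes other = other
    ... | no noOther = ⊥-elim (natural-not-between (y i) (proj₁ others) (X i j)
                                 (trans (sym (proj₁ (proj₂ tr) i)) (proj₂ others)) frac)
      where
      zeroOne : ∀ j′ → j′ ≢ j → ZeroOne (X i j′)
      zeroOne j′ j′≢j with ZeroOne? (X i j′)
      ... | yes z01 = z01
      ... | no ¬z01 = ⊥-elim (noOther (j′ , j′≢j , trichotomy01 (X≥0 i j′) (entry≤1 i j′) ¬z01))
      others : Σ ℕ λ N → rowSum X i ≡ X i j + ℕtoℚ N
      others = sumℚ-zeroOne-except n (λ j′ → X i j′) j zeroOne

    FractionalCell : Set
    FractionalCell = Σ (Fin m × Fin n) λ c → Fractional X (proj₁ c) (proj₂ c)

    nextCell : FractionalCell → FractionalCell
    nextCell ((i , j) , frac) =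
      let (i′ , _ , frac′) = otherInColumn i j frac
          (j′ , _ , frac″) = otherInRow i′ j frac′
      in (i′ , j′) , frac″

    fractionalWalk : FractionalCell → Walk (Fractional X)
    fractionalWalk start = record
      { row = λ t → proj₁ (proj₁ (cell t))
      ; col = λ t → proj₂ (proj₁ (cell t))
      ; edge = λ t → proj₂ (cell t)
      ; edge′ = λ t → proj₂ (proj₂ (inColumn t))
      ; row-moves = λ t → proj₁ (proj₂ (inColumn t))
      ; col-moves = λ t → proj₁ (proj₂ (otherInRow _ _ (proj₂ (proj₂ (inColumn t)))))
      }
      where
      cell : ℕ → FractionalCell
      cell zero = start
      cell (suc t) = nextCell (cell t)
      inColumn : ∀ t → Σ (Fin m) λ i′ → (i′ ≢ proj₁ (proj₁ (cell t))) × Fractional X i′ (proj₂ (proj₁ (cell t)))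
      inColumn t = otherInColumn (proj₁ (proj₁ (cell t))) (proj₂ (proj₁ (cell t))) (proj₂ (cell t))

    fractionalSplit : ∀ i j → Fractional X i j → Split X
    fractionalSplit i j frac with findCycle (fractionalWalk ((i , j) , frac))
    ... | inj₁ cyc = cycleSplit X X≥0 proj₁ cyc
    ... | inj₂ cyc = transposeSplit (cycleSplit (transpose X) (λ j i → X≥0 i j) proj₁ cyc)

sumℚL-cong : ∀ {A : Set} (xs : List A) {f g : A → ℚ} → (∀ x → f x ≡ g x) → sumℚL xs f ≡ sumℚL xs g
sumℚL-cong [] eq = refl
sumℚL-cong (x ∷ xs) eq = cong₂ _+_ (eq x) (sumℚL-cong xs eq)

sumℚL-congᴬ : ∀ {A : Set} {P : A → Set} {xs : List A} {f g : A → ℚ} → All P xs →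
              (∀ x → P x → f x ≡ g x) → sumℚL xs f ≡ sumℚL xs g
sumℚL-congᴬ [] eq = refl
sumℚL-congᴬ {xs = x ∷ _} (px ∷ pxs) eq = cong₂ _+_ (eq x px) (sumℚL-congᴬ pxs eq)

sumℚL-scaleˡ : ∀ {A : Set} (xs : List A) (f : A → ℚ) c → sumℚL xs (λ x → c * f x) ≡ c * sumℚL xs f
sumℚL-scaleˡ [] f c = sym (ℚP.*-zeroʳ c)
sumℚL-scaleˡ (x ∷ xs) f c = trans (cong (λ s → c * f x + s) (sumℚL-scaleˡ xs f c))
                                  (sym (ℚP.*-distribˡ-+ c (f x) _))

sumℚL-scaleʳ : ∀ {A : Set} (xs : List A) (f : A → ℚ) c → sumℚL xs (λ x → f x * c) ≡ sumℚL xs f * c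
sumℚL-scaleʳ [] f c = sym (ℚP.*-zeroˡ c)
sumℚL-scaleʳ (x ∷ xs) f c = trans (cong (λ s → f x * c + s) (sumℚL-scaleʳ xs f c))
                                  (sym (ℚP.*-distribʳ-+ c (f x) _))

sumℚL-++ : ∀ {A : Set} (xs ys : List A) (f : A → ℚ) → sumℚL (xs ++ ys) f ≡ sumℚL xs f + sumℚL ys f
sumℚL-++ [] ys f = sym (ℚP.+-identityˡ _)
sumℚL-++ (x ∷ xs) ys f = trans (cong (λ s → f x + s) (sumℚL-++ xs ys f)) (sym (ℚP.+-assoc (f x) _ _))

sumℚL-map : ∀ {A B : Set} (xs : List A) (g : A → B) (f : B → ℚ) → sumℚL (map g xs) f ≡ sumℚL xs (λ x → f (g x))
sumℚL-map [] g f = refl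
sumℚL-map (x ∷ xs) g f = cong (λ s → f (g x) + s) (sumℚL-map xs g f)

sumℚ-sumℚL : ∀ {A : Set} n (xs : List A) (F : Fin n → A → ℚ) →
             sumℚ n (λ j → sumℚL xs (F j)) ≡ sumℚL xs (λ x → sumℚ n (λ j → F j x))
sumℚ-sumℚL n [] F = sumℚ-zero n
sumℚ-sumℚL n (x ∷ xs) F = trans (sumℚ-+ n (λ j → F j x) (λ j → sumℚL xs (F j)))
  (cong (λ s → sumℚ n (λ j → F j x) + s) (sumℚ-sumℚL n xs F))

Weighted : ℕ → ℕ → Set
Weighted m n = ℚ × Matℤ m n

Hull : {m n : ℕ} → (Matℤ m n → Set) → Matℚ m n → Set
Hull {m} {n} G X = Σ (List (Weighted m n)) λ ws →
  All (λ x → (0ℚ ≤ proj₁ x) × G (proj₂ x)) ws ×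
  (sumℚL ws proj₁ ≡ 1ℚ) ×
  (∀ i j → X i j ≡ sumℚL ws (λ x → proj₁ x * ℤtoℚ (proj₂ x i j)))

-- Sums of entries along a path of cells (e.g. a row or a column): if every
-- member of G has sum c along it, so does every convex combination.
hull-sum : ∀ {m n} {G : Matℤ m n → Set} k (r : Fin k → Fin m) (c : Fin k → Fin n) (total : ℕ) →
  (∀ A → G A → sumℤ k (λ t → A (r t) (c t)) ≡ + total) →
  ∀ {X} → Hull G X → sumℚ k (λ t → X (r t) (c t)) ≡ ℕtoℚ total
hull-sum k r c total sums {X} (ws , members , weights≡1 , X≡) = begin
  sumℚ k (λ t → X (r t) (c t))
    ≡⟨ sumℚ-cong k (λ t → X≡ (r t) (c t)) ⟩
  sumℚ k (λ t → sumℚL ws (λ x → proj₁ x * ℤtoℚ (proj₂ x (r t) (c t))))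
    ≡⟨ sumℚ-sumℚL k ws _ ⟩
  sumℚL ws (λ x → sumℚ k (λ t → proj₁ x * ℤtoℚ (proj₂ x (r t) (c t))))
    ≡⟨ sumℚL-congᴬ members (λ x member → trans (sumℚ-scale k (proj₁ x) _)
         (cong (proj₁ x *_) (trans (sym (ℤtoℚ-sumℤ k _)) (cong ℤtoℚ (sums (proj₂ x) (proj₂ member)))))) ⟩
  sumℚL ws (λ x → proj₁ x * ℕtoℚ total)
    ≡⟨ sumℚL-scaleʳ ws proj₁ (ℕtoℚ total) ⟩
  sumℚL ws proj₁ * ℕtoℚ total
    ≡⟨ cong (_* ℕtoℚ total) weights≡1 ⟩
  1ℚ * ℕtoℚ total
    ≡⟨ ℚP.*-identityˡ (ℕtoℚ total) ⟩
  ℕtoℚ total ∎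
  where open ≡-Reasoning

hull-point : ∀ {m n} {G : Matℤ m n → Set} {X : Matℚ m n} (A : Matℤ m n) → G A →
             (∀ i j → X i j ≡ ℤtoℚ (A i j)) → Hull G X
hull-point A member X≡A = ((1ℚ , A) ∷ []) , ((ℚP.<⇒≤ (ℚP.positive⁻¹ 1ℚ) , member) ∷ []) , refl ,
  λ i j → trans (X≡A i j) (sym (trans (ℚP.+-identityʳ _) (ℚP.*-identityˡ _)))

scale : ∀ {m n} → ℚ → Weighted m n → Weighted m n
scale c (w , A) = c * w , A

scaled-weights : ∀ {m n} c (ws : List (Weighted m n)) → sumℚL (map (scale c) ws) proj₁ ≡ c * sumℚL ws proj₁
scaled-weights c ws = trans (sumℚL-map ws (scale c) proj₁) (sumℚL-scaleˡ ws proj₁ c)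

scaled-combination : ∀ {m n} c (ws : List (Weighted m n)) (g : Matℤ m n → ℚ) →
  sumℚL (map (scale c) ws) (λ x → proj₁ x * g (proj₂ x)) ≡ c * sumℚL ws (λ x → proj₁ x * g (proj₂ x))
scaled-combination c ws g = trans (sumℚL-map ws (scale c) _)
  (trans (sumℚL-cong ws (λ x → ℚP.*-assoc c (proj₁ x) (g (proj₂ x))))
         (sumℚL-scaleˡ ws (λ x → proj₁ x * g (proj₂ x)) c))

hull-combine : ∀ {m n} {G : Matℤ m n → Set} {X X₁ X₂ : Matℚ m n} (t w : ℚ) →
  0ℚ ≤ t → 0ℚ ≤ w → t + w ≡ 1ℚ → (∀ i j → X i j ≡ t * X₁ i j + w * X₂ i j) →
  Hull G X₁ → Hull G X₂ → Hull G X
hull-combine {m} {n} {G} t w t≥0 w≥0 t+w≡1 X≡ (ws₁ , members₁ , weights₁ , X₁≡) (ws₂ , members₂ , weights₂ , X₂≡) =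
  ws ,
  AllP.++⁺ (AllP.map⁺ (All.map (rescale t≥0) members₁)) (AllP.map⁺ (All.map (rescale w≥0) members₂)) ,
  trans (sumℚL-++ (map (scale t) ws₁) _ proj₁)
        (trans (cong₂ _+_ (weight t ws₁ weights₁) (weight w ws₂ weights₂)) t+w≡1) ,
  λ i j → trans (X≡ i j) (sym (trans (sumℚL-++ (map (scale t) ws₁) _ _)
            (cong₂ _+_ (trans (scaled-combination t ws₁ _) (cong (t *_) (sym (X₁≡ i j))))
                       (trans (scaled-combination w ws₂ _) (cong (w *_) (sym (X₂≡ i j)))))))
  where
  ws : List (Weighted m n)
  ws = map (scale t) ws₁ ++ map (scale w) ws₂
  rescale : ∀ {c} → 0ℚ ≤ c → ∀ {x : Weighted m n} → (0ℚ ≤ proj₁ x) × G (proj₂ x) → (0ℚ ≤ c * proj₁ x) × G (proj₂ x)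
  rescale c≥0 (w≥0 , member) = 0≤* c≥0 w≥0 , member
  weight : ∀ c (ws′ : List (Weighted m n)) → sumℚL ws′ proj₁ ≡ 1ℚ → sumℚL (map (scale c) ws′) proj₁ ≡ c
  weight c ws′ total≡1 = trans (scaled-weights c ws′) (trans (cong (c *_) total≡1) (ℚP.*-identityʳ c))

sumℕ : ∀ n → (Fin n → ℕ) → ℕ
sumℕ zero f = 0
sumℕ (suc n) f = f Fin.zero Nat.+ sumℕ n (λ i → f (Fin.suc i))

sumℕ-mono : ∀ n (f g : Fin n → ℕ) → (∀ i → f i Nat.≤ g i) → sumℕ n f Nat.≤ sumℕ n g
sumℕ-mono zero f g f≤g = z≤n
sumℕ-mono (suc n) f g f≤g = ℕP.+-mono-≤ (f≤g Fin.zero) (sumℕ-mono n _ _ (λ i → f≤g (Fin.suc i)))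

sumℕ-strict : ∀ n (f g : Fin n → ℕ) → (∀ i → f i Nat.≤ g i) → ∀ a → f a Nat.< g a → sumℕ n f Nat.< sumℕ n g
sumℕ-strict (suc n) f g f≤g Fin.zero lt = ℕP.+-mono-<-≤ lt (sumℕ-mono n _ _ (λ i → f≤g (Fin.suc i)))
sumℕ-strict (suc n) f g f≤g (Fin.suc a) lt =
  ℕP.+-mono-≤-< (f≤g Fin.zero) (sumℕ-strict n _ _ (λ i → f≤g (Fin.suc i)) a lt)

countNonzero : ∀ {x : ℚ} → Dec (x ≡ 0ℚ) → ℕ
countNonzero (yes _) = 0
countNonzero (no _) = 1

countNonzero-mono : ∀ x y → (x ≡ 0ℚ → y ≡ 0ℚ) → countNonzero (y ℚP.≟ 0ℚ) Nat.≤ countNonzero (x ℚP.≟ 0ℚ)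
countNonzero-mono x y zeros with x ℚP.≟ 0ℚ | y ℚP.≟ 0ℚ
... | _ | yes _ = z≤n
... | no _ | no _ = ℕP.≤-refl
... | yes x≡0 | no y≢0 = ⊥-elim (y≢0 (zeros x≡0))

countNonzero-drop : ∀ x y → x ≢ 0ℚ → y ≡ 0ℚ → countNonzero (y ℚP.≟ 0ℚ) Nat.< countNonzero (x ℚP.≟ 0ℚ)
countNonzero-drop x y x≢0 y≡0 with x ℚP.≟ 0ℚ | y ℚP.≟ 0ℚ
... | yes x≡0 | _ = ⊥-elim (x≢0 x≡0)
... | no _ | yes _ = ℕP.≤-refl
... | no _ | no y≢0 = ⊥-elim (y≢0 y≡0)

support : ∀ {m n} → Matℚ m n → ℕ
support {m} {n} X = sumℕ m (λ i → sumℕ n (λ j → countNonzero (X i j ℚP.≟ 0ℚ)))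

smallerSupport⇒< : ∀ {m n} (X Y : Matℚ m n) → SmallerSupport X Y → support Y Nat.< support X
smallerSupport⇒< {m} {n} X Y (zeros , i₀ , j₀ , X≢0 , Y≡0) =
  sumℕ-strict m _ _ (λ i → sumℕ-mono n _ _ (λ j → countNonzero-mono (X i j) (Y i j) (zeros i j))) i₀
    (sumℕ-strict n _ _ (λ j → countNonzero-mono (X i₀ j) (Y i₀ j) (zeros i₀ j)) j₀
      (countNonzero-drop (X i₀ j₀) (Y i₀ j₀) X≢0 Y≡0))

Bit : ℤ → Set
Bit x = (x ≡ + 0) ⊎ (x ≡ + 1)

sumℤ-bits : ∀ k (f : Fin k → ℤ) → (∀ i → Bit (f i)) → Σ ℕ λ K → sumℤ k f ≡ + K
sumℤ-bits zero f _ = 0 , refl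
sumℤ-bits (suc k) f bits with sumℤ-bits k (λ i → f (Fin.suc i)) (λ i → bits (Fin.suc i)) | bits Fin.zero
... | K , sum≡K | inj₁ f₀≡0 = K , cong₂ ℤ._+_ f₀≡0 sum≡K
... | K , sum≡K | inj₂ f₀≡1 = suc K , cong₂ ℤ._+_ f₀≡1 sum≡K

prefixSum-bits : ∀ k (f : Fin k → ℤ) → (∀ i → Bit (f i)) → ∀ r →
  Σ ℕ λ a → Σ ℕ λ b → (psumℤ k f r ≡ + a) × (sumℤ k f ≡ + (a Nat.+ b))
prefixSum-bits zero f _ r = 0 , 0 , refl , refl
prefixSum-bits (suc k) f bits zero with sumℤ-bits (suc k) f bits
... | K , sum≡K = 0 , K , refl , sum≡K
prefixSum-bits (suc k) f bits (suc r)
  with prefixSum-bits k (λ i → f (Fin.suc i)) (λ i → bits (Fin.suc i)) r | bits Fin.zero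
... | a , b , prefix≡a , sum≡ | inj₁ f₀≡0 = a , b , cong₂ ℤ._+_ f₀≡0 prefix≡a , cong₂ ℤ._+_ f₀≡0 sum≡
... | a , b , prefix≡a , sum≡ | inj₂ f₀≡1 = suc a , b , cong₂ ℤ._+_ f₀≡1 prefix≡a , cong₂ ℤ._+_ f₀≡1 sum≡

bit⇒sign : ∀ {x} → Bit x → IsSignEntry x
bit⇒sign (inj₁ x≡0) = inj₂ (inj₁ x≡0)
bit⇒sign (inj₂ x≡1) = inj₂ (inj₂ x≡1)

bits⇒signMatrix : ∀ {m n} (A : Matℤ m n) → (∀ i j → Bit (A i j)) →
  (∀ j → Σ ℕ λ c → (sumℤ m (λ i → A i j) ≡ + c) × (c Nat.≤ 1)) → IsSignMatrix A
bits⇒signMatrix {m} {n} A bits colSums = (λ i j → bit⇒sign (bits i j)) , colPrefix , rowPrefix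
  where
  atMostOne : ∀ a b → a Nat.+ b Nat.≤ 1 → Bit (+ a)
  atMostOne zero b _ = inj₁ refl
  atMostOne (suc zero) b _ = inj₂ refl
  atMostOne (suc (suc a)) b (s≤s ())
  colPrefix : ∀ j r → r Nat.≤ m → (psumℤ m (λ i → A i j) r ≡ + 0) ⊎ (psumℤ m (λ i → A i j) r ≡ + 1)
  colPrefix j r _ with prefixSum-bits m (λ i → A i j) (λ i → bits i j) r | colSums j
  ... | a , b , prefix≡a , sum≡ | c , sum≡c , c≤1 with atMostOne a b (subst (Nat._≤ 1) (ℤP.+-injective (trans (sym sum≡c) sum≡)) c≤1)
  ...   | inj₁ a≡0 = inj₁ (trans prefix≡a a≡0)
  ...   | inj₂ a≡1 = inj₂ (trans prefix≡a a≡1)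
  rowPrefix : ∀ i r → r Nat.≤ n → + 0 ℤ.≤ psumℤ n (λ j → A i j) r
  rowPrefix i r _ with prefixSum-bits n (λ j → A i j) (λ j → bits i j) r
  ... | a , _ , prefix≡a , _ = subst (+ 0 ℤ.≤_) (sym prefix≡a) (ℤ.+≤+ z≤n)

SignMatrixWith : ∀ {m n} → (Fin m → ℕ) → (Fin n → ℕ) → Matℤ m n → Set
SignMatrixWith {m} {n} y z A =
  IsSignMatrix A × (∀ i → sumℤ n (λ j → A i j) ≡ + y i) × (∀ j → sumℤ m (λ i → A i j) ≡ + z j)

module Decomposition {m n : ℕ} (y : Fin m → ℕ) (z : Fin n → ℕ) (z≤1 : ∀ j → z j Nat.≤ 1) where
  open IntegerMargins y z z≤1

  toBit : ∀ {x} → ZeroOne x → ℤ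
  toBit (inj₁ _) = + 0
  toBit (inj₂ _) = + 1

  toBit-bit : ∀ {x} (p : ZeroOne x) → Bit (toBit p)
  toBit-bit (inj₁ _) = inj₁ refl
  toBit-bit (inj₂ _) = inj₂ refl

  toBit-value : ∀ {x} (p : ZeroOne x) → x ≡ ℤtoℚ (toBit p)
  toBit-value (inj₁ x≡0) = x≡0
  toBit-value (inj₂ x≡1) = x≡1

  zeroOne-hull : ∀ X → Transport X → (∀ i j → ZeroOne (X i j)) → Hull (SignMatrixWith y z) X
  zeroOne-hull X tr zeroOne = hull-point A (bits⇒signMatrix A (λ i j → toBit-bit (zeroOne i j)) colSums ,
                                            rowSums , λ j → proj₁ (proj₂ (colSums j)))
                                        (λ i j → toBit-value (zeroOne i j))
    where
    A : Matℤ m n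
    A i j = toBit (zeroOne i j)
    margin : ∀ k (r : Fin k → Fin m) (c : Fin k → Fin n) total →
             sumℚ k (λ t → X (r t) (c t)) ≡ ℕtoℚ total → sumℤ k (λ t → A (r t) (c t)) ≡ + total
    margin k r c total sum≡ = ℤtoℚ-injective (trans (ℤtoℚ-sumℤ k _)
      (trans (sym (sumℚ-cong k (λ t → toBit-value (zeroOne (r t) (c t))))) sum≡))
    rowSums : ∀ i → sumℤ n (λ j → A i j) ≡ + y i
    rowSums i = margin n (λ _ → i) (λ j → j) (y i) (proj₁ (proj₂ tr) i)
    colSums : ∀ j → Σ ℕ λ c → (sumℤ m (λ i → A i j) ≡ + c) × (c Nat.≤ 1)
    colSums j = z j , margin m (λ i → i) (λ _ → j) (z j) (proj₂ (proj₂ tr) j) , z≤1 j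

  piece-transport : ∀ {X} → Transport X → (P : Piece X) → Transport (Piece.matrix P)
  piece-transport (_ , rows , cols) P =
    nonneg , (λ i → trans (proj₁ sameMargins i) (rows i)) , (λ j → trans (proj₂ sameMargins j) (cols j))
    where open Piece P

  decompose : ∀ X → Transport X → Hull (SignMatrixWith y z) X
  decompose X tr = go X tr (<-wellFounded (support X))
    where
    go : ∀ X → Transport X → Acc Nat._<_ (support X) → Hull (SignMatrixWith y z) X
    go X tr (acc smaller) with FinP.all? (λ i → FinP.all? (λ j → ZeroOne? (X i j)))
    ... | yes zeroOne = zeroOne-hull X tr zeroOne
    ... | no notZeroOne = hull-combine t w t≥0 w≥0 t+w≡1 combination
          (go (Piece.matrix first) (piece-transport tr first)
              (smaller (smallerSupport⇒< X _ (Piece.smaller first))))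
          (go (Piece.matrix second) (piece-transport tr second)
              (smaller (smallerSupport⇒< X _ (Piece.smaller second))))
      where
      open FractionalCells X tr
      badRow : Σ (Fin m) λ i → ¬ (∀ j → ZeroOne (X i j))
      badRow = FinP.¬∀⟶∃¬ m _ (λ i → FinP.all? (λ j → ZeroOne? (X i j))) notZeroOne
      i₀ : Fin m
      i₀ = proj₁ badRow
      badCell : Σ (Fin n) λ j → ¬ ZeroOne (X i₀ j)
      badCell = FinP.¬∀⟶∃¬ n _ (λ j → ZeroOne? (X i₀ j)) (proj₂ badRow)
      j₀ : Fin n
      j₀ = proj₁ badCell
      open Split (fractionalSplit i₀ j₀ (trichotomy01 (X≥0 i₀ j₀) (entry≤1 i₀ j₀) (proj₂ badCell)))

colTarget≤1 : ∀ {k n} (v : Vec (Fin n) k) j → colTarget v j Nat.≤ 1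
colTarget≤1 v j = bit≤1 _
  where
  bit≤1 : ∀ b → (if b then 1 else 0) Nat.≤ 1
  bit≤1 true = s≤s z≤n
  bit≤1 false = z≤n

-- The inclusion (⊆) is hull-sum applied
-- to rows and columns; (⊇) is the decomposition.
theorem9p12 : (k n : ℕ) (lam : Vec ℕ k) (v : Vec (Fin n) k) →
    IsPartition lam → 1 Nat.≤ n → StrictlyIncreasing v →
    (X : Matℚ (largest lam) n) →
    (InP n v lam X × Nonneg X) ⇔
    InTransport (largest lam) n (λ i → ℕtoℚ (rowTarget lam i)) (λ j → ℕtoℚ (colTarget v j)) X
theorem9p12 k n lam v _ _ _ X = mk⇔ forward backward
  where
  open Decomposition (rowTarget lam) (colTarget v) (colTarget≤1 v)
  forward : InP n v lam X × Nonneg X →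
            InTransport (largest lam) n (λ i → ℕtoℚ (rowTarget lam i)) (λ j → ℕtoℚ (colTarget v j)) X
  forward (inHull , X≥0) =
    X≥0 ,
    (λ i → hull-sum n (λ _ → i) (λ j → j) (rowTarget lam i) (λ A member → proj₁ (proj₂ member) i) inHull) ,
    (λ j → hull-sum (largest lam) (λ i → i) (λ _ → j) (colTarget v j) (λ A member → proj₂ (proj₂ member) j) inHull)
  backward : InTransport (largest lam) n (λ i → ℕtoℚ (rowTarget lam i)) (λ j → ℕtoℚ (colTarget v j)) X →
             InP n v lam X × Nonneg X
  backward tr = decompose X tr , proj₁ tr
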